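{- Let $m\ge 2$ and let $(d_1,\dots,d_m)$ and $(c_0,\dots,c_m)$ be sequences of (not necessarily distinct) natural numbers such that $\frac{d_i}{c_{i-1}}=z$ for all $1\le i\le m$, for some rational $z$ with $0<z<1$. Then there exists a non-disjoint $(c_0\cdots c_m,\,m,\,c_0\cdots c_m z,\,c_0\cdots c_m z^2)$-PSEDF in $\mathbb{Z}_{c_0\cdots c_m}$.
   Context: For subsets $A,B$ of an additively written group $G$, $\Delta(A,B)$ denotes the multiset $\{a-b:a\in A,b\in B\}$ (one entry per pair). For $\lambda\in\mathbb{N}$, $\lambda G$ is the multiset containing every element of $G$ exactly $\lambda$ times. For a group $G$ of order $v$ and $m>1$, a family of $k$-subsets $\{A_1,\dots,A_m\}$ of $G$ is a non-disjoint $(v,m,k,\lambda)$-PSEDF if $\Delta(A_i,A_j)=\lambda G$ for all $1\le i\ne j\le m$. -}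

module Defs where

open import Data.Nat using (ℕ; zero; suc; _+_; _*_; _≟_)
open import Data.Bool using (Bool; true; false; _∧_; if_then_else_)
open import Data.Fin using (Fin; toℕ)
open import Data.Fin.Subset using (Subset; ∣_∣)
open import Data.Vec using (lookup)
open import Data.List using (List; map; allFin)
open import Data.Nat.ListAction using (sum; product)
open import Data.Sum using (_⊎_)
open import Relation.Binary.PropositionalEquality using (_≡_; _≢_)
open import Relation.Nullary.Decidable using (Dec; ⌊_⌋; _⊎-dec_)

-- Elements of ℤ_N are represented by Fin N (residues 0..N-1).
-- In ℤ_N :  a - b = g  iff  g + b ≡ a (mod N), i.e. (as residues)
-- toℕ g + toℕ b equals toℕ a or toℕ a + N.
IsDiff : (N : ℕ) → Fin N → Fin N → Fin N → Set
IsDiff N a b g = (toℕ g + toℕ b ≡ toℕ a) ⊎ (toℕ g + toℕ b ≡ toℕ a + N)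

isDiff? : (N : ℕ) → (a b g : Fin N) → Dec (IsDiff N a b g)
isDiff? N a b g = (toℕ g + toℕ b ≟ toℕ a) ⊎-dec (toℕ g + toℕ b ≟ toℕ a + N)

ΣFin : (N : ℕ) → (Fin N → ℕ) → ℕ
ΣFin N f = sum (map f (allFin N))

ΔCount : (N : ℕ) → Subset N → Subset N → Fin N → ℕ
ΔCount N A B g =
  ΣFin N λ a → ΣFin N λ b →
    if lookup A a ∧ lookup B b ∧ ⌊ isDiff? N a b g ⌋ then 1 else 0

IsPSEDF : (v m k λ' : ℕ) → (Fin m → Subset v) → Set
IsPSEDF v m k λ' A =
  (1 Data.Nat.< m)
  Data.Product.× (∀ i → ∣ A i ∣ ≡ k)
  Data.Product.× (∀ i j → i ≢ j → ∀ g → ΔCount v (A i) (A j) g ≡ λ')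
  where import Data.Product; import Data.Nat

prodFin : (n : ℕ) → (Fin n → ℕ) → ℕ
prodFin n c = product (map c (allFin n))

open import Data.Rational using (ℚ; _/_)
open import Data.Integer using (+_)
ℚ[_] : ℕ → ℚ
ℚ[ n ] = (+ n) / 1

-- Write residues modulo N = c_0 ⋯ c_m in mixed radix, digit q having base c_q and place value
-- P_q = c_0 ⋯ c_{q-1}, and let A_i be the set of residues whose digit i is below d_i; it has
-- N d_i / c_i = N z elements. For i < j, membership in A_i depends only on the residue mod P_j,
-- while along a residue class mod P_j a translation moves digit j cyclically through ℤ_{c_j},
-- N / (c_j P_j) times over. Hence every g is a difference a - b with a ∈ A_i, b ∈ A_j exactly
-- (N / (c_j P_j)) · d_j · |A_i ∩ [0, P_j)| = (N z / P_j) · (P_j z) = N z² times.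
module Submission where

open import Data.Bool using (Bool; true; false; _∧_; if_then_else_)
open import Data.Fin using (Fin; toℕ; zero; suc; inject₁; fromℕ<)
open import Data.Fin.Properties using (toℕ<n; toℕ-inject₁; toℕ-injective)
open import Data.Fin.Subset using (Subset; ∣_∣)
import Data.Integer as ℤ
import Data.Integer.Properties as ℤ
import Data.List as List
open import Data.List.Properties using (map-tabulate; tabulate-cong)
open import Data.Nat
open import Data.Nat.Coprimality as Coprimality using (1-coprimeTo)
open import Data.Nat.Divisibility using (_∣_; divides)
open import Data.Nat.DivMod
open import Data.Nat.ListAction using (sum; product)
open import Data.Nat.Properties
open import Data.Nat.Solver using (module +-*-Solver)
open import Data.Product using (Σ; _×_; ∃; _,_; proj₁)
open import Data.Rational as ℚ using (ℚ; mkℚ; 0ℚ; 1ℚ)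
import Data.Rational.Properties as ℚ
open import Data.Rational.Solver renaming (module +-*-Solver to ℚ-Solver)
open import Data.Sum using (inj₁; inj₂)
open import Data.Vec using (_∷_; tabulate; lookup)
open import Data.Vec.Properties using (lookup∘tabulate)
open import Function using (_∘_; id; const)
open import Function.Bundles using (_⇔_; mk⇔)
open import Relation.Binary.Definitions using (Tri; tri<; tri≈; tri>)
open import Relation.Binary.PropositionalEquality
open import Relation.Nullary.Decidable using (⌊_⌋; isYes≗does; does-⇔; yes; no)
open import Relation.Nullary.Negation using (contradiction)

open import Defs

open ≡-Reasoning

𝟙 : Bool → ℕ
𝟙 b = if b then 1 else 0

𝟙-∧ : ∀ x y w → 𝟙 (x ∧ y ∧ w) ≡ 𝟙 x * 𝟙 y * 𝟙 w
𝟙-∧ true  true  true  = refl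
𝟙-∧ true  true  false = refl
𝟙-∧ true  false _     = refl
𝟙-∧ false _     _     = refl

∑ : ℕ → (ℕ → ℕ) → ℕ
∑ zero    f = 0
∑ (suc n) f = f 0 + ∑ n (f ∘ suc)

∑-cong : ∀ n {f g} → (∀ x → x < n → f x ≡ g x) → ∑ n f ≡ ∑ n g
∑-cong zero    f≡g = refl
∑-cong (suc n) f≡g = cong₂ _+_ (f≡g 0 z<s) (∑-cong n (λ x x<n → f≡g (suc x) (s<s x<n)))

∑-distrib-+ : ∀ n f g → ∑ n (λ x → f x + g x) ≡ ∑ n f + ∑ n g
∑-distrib-+ zero    f g = refl
∑-distrib-+ (suc n) f g = begin
  f 0 + g 0 + ∑ n (λ x → f (suc x) + g (suc x))  ≡⟨ cong (f 0 + g 0 +_) (∑-distrib-+ n (f ∘ suc) (g ∘ suc)) ⟩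
  f 0 + g 0 + (∑ n (f ∘ suc) + ∑ n (g ∘ suc))
    ≡⟨ solve 4 (λ a b c d → (a :+ b) :+ (c :+ d) := (a :+ c) :+ (b :+ d)) refl (f 0) (g 0) _ _ ⟩
  f 0 + ∑ n (f ∘ suc) + (g 0 + ∑ n (g ∘ suc))    ∎
  where open +-*-Solver

∑-*ˡ : ∀ n k f → ∑ n (λ x → k * f x) ≡ k * ∑ n f
∑-*ˡ zero    k f = sym (*-zeroʳ k)
∑-*ˡ (suc n) k f = trans (cong (k * f 0 +_) (∑-*ˡ n k (f ∘ suc))) (sym (*-distribˡ-+ k (f 0) _))

∑-const : ∀ n k → ∑ n (const k) ≡ n * k
∑-const zero    k = refl
∑-const (suc n) k = cong (k +_) (∑-const n k)

∑-zero : ∀ n → ∑ n (const 0) ≡ 0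
∑-zero n = trans (∑-const n 0) (*-zeroʳ n)

∑-+ : ∀ a b f → ∑ (a + b) f ≡ ∑ a f + ∑ b (λ x → f (a + x))
∑-+ zero    b f = refl
∑-+ (suc a) b f = trans (cong (f 0 +_) (∑-+ a b (f ∘ suc))) (sym (+-assoc (f 0) _ _))

∑-suc : ∀ n f → ∑ (suc n) f ≡ ∑ n f + f n
∑-suc n f = begin
  ∑ (suc n) f                     ≡⟨ cong (λ k → ∑ k f) (+-comm 1 n) ⟩
  ∑ (n + 1) f                     ≡⟨ ∑-+ n 1 f ⟩
  ∑ n f + (f (n + 0) + 0)         ≡⟨ cong (λ k → ∑ n f + k) (trans (+-identityʳ _) (cong f (+-identityʳ n))) ⟩
  ∑ n f + f n                     ∎

∑-* : ∀ a b f → ∑ (a * b) f ≡ ∑ a (λ s → ∑ b (λ t → f (s * b + t)))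
∑-* zero    b f = refl
∑-* (suc a) b f = begin
  ∑ (b + a * b) f                                        ≡⟨ ∑-+ b (a * b) f ⟩
  ∑ b f + ∑ (a * b) (λ x → f (b + x))                    ≡⟨ cong (∑ b f +_) (∑-* a b _) ⟩
  ∑ b f + ∑ a (λ s → ∑ b (λ t → f (b + (s * b + t))))
    ≡⟨ cong (∑ b f +_) (∑-cong a (λ s _ → ∑-cong b (λ t _ → cong f (sym (+-assoc b (s * b) t))))) ⟩
  ∑ b f + ∑ a (λ s → ∑ b (λ t → f (b + s * b + t)))      ∎

∑-comm : ∀ n k (f : ℕ → ℕ → ℕ) → ∑ n (λ a → ∑ k (f a)) ≡ ∑ k (λ b → ∑ n (λ a → f a b))
∑-comm zero    k f = sym (∑-zero k)
∑-comm (suc n) k f = trans (cong (∑ k (f 0) +_) (∑-comm n k (f ∘ suc)))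
  (sym (∑-distrib-+ k (f 0) (λ b → ∑ n (λ a → f (suc a) b))))

∑-select : ∀ n (f : ℕ → ℕ) {y} → y < n → ∑ n (λ a → f a * 𝟙 (a ≡ᵇ y)) ≡ f y
∑-select (suc n) f {zero}  _         = begin
  f 0 * 1 + ∑ n (λ a → f (suc a) * 0)  ≡⟨ cong₂ _+_ (*-identityʳ (f 0)) (∑-cong n (λ a _ → *-zeroʳ (f (suc a)))) ⟩
  f 0 + ∑ n (const 0)                  ≡⟨ cong (f 0 +_) (∑-zero n) ⟩
  f 0 + 0                              ≡⟨ +-identityʳ (f 0) ⟩
  f 0                                  ∎
∑-select (suc n) f {suc y} (s<s y<n) =
  trans (cong (_+ ∑ n (λ a → f (suc a) * 𝟙 (a ≡ᵇ y))) (*-zeroʳ (f 0))) (∑-select n (f ∘ suc) y<n)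

∑-indicator-< : ∀ c {d} → d ≤ c → ∑ c (λ t → 𝟙 (t <ᵇ d)) ≡ d
∑-indicator-< c       {zero}  z≤n       = ∑-zero c
∑-indicator-< (suc c) {suc d} (s≤s d≤c) = cong suc (∑-indicator-< c d≤c)

[m%n+o]%n≡[m+o]%n : ∀ m o n .{{_ : NonZero n}} → (m % n + o) % n ≡ (m + o) % n
[m%n+o]%n≡[m+o]%n m o n = begin
  (m % n + o) % n              ≡⟨ %-distribˡ-+ (m % n) o n ⟩
  (m % n % n + o % n) % n      ≡⟨ cong (λ u → (u + o % n) % n) (m%n%n≡m%n m n) ⟩
  (m % n + o % n) % n          ≡⟨ %-distribˡ-+ m o n ⟨
  (m + o) % n                  ∎

∑-rotate₁ : ∀ n h → ∑ (suc n) (λ t → h (suc t % suc n)) ≡ ∑ (suc n) h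
∑-rotate₁ n h = begin
  ∑ (suc n) (λ t → h (suc t % suc n))          ≡⟨ ∑-suc n _ ⟩
  ∑ n (λ t → h (suc t % suc n)) + h (suc n % suc n)
    ≡⟨ cong₂ _+_ (∑-cong n (λ t t<n → cong h (m<n⇒m%n≡m (s<s t<n)))) (cong h (n%n≡0 (suc n))) ⟩
  ∑ n (h ∘ suc) + h 0                           ≡⟨ +-comm _ (h 0) ⟩
  ∑ (suc n) h                                   ∎

∑-rotate : ∀ n .{{_ : NonZero n}} k h → ∑ n (λ t → h ((t + k) % n)) ≡ ∑ n h
∑-rotate (suc n) zero    h =
  ∑-cong (suc n) (λ t t<n → cong h (trans (cong (_% suc n) (+-identityʳ t)) (m<n⇒m%n≡m t<n)))
∑-rotate (suc n) (suc k) h = begin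
  ∑ (suc n) (λ t → h ((t + suc k) % suc n))   ≡⟨ ∑-cong (suc n) (λ t _ → cong h (rotate-by-one t)) ⟩
  ∑ (suc n) (λ t → h′ (suc t % suc n))        ≡⟨ ∑-rotate₁ n h′ ⟩
  ∑ (suc n) h′                                ≡⟨ ∑-rotate (suc n) k h ⟩
  ∑ (suc n) h                                 ∎
  where
  h′ : ℕ → ℕ
  h′ u = h ((u + k) % suc n)
  rotate-by-one : ∀ t → (t + suc k) % suc n ≡ (suc t % suc n + k) % suc n
  rotate-by-one t = trans (cong (_% suc n) (+-suc t k)) (sym ([m%n+o]%n≡[m+o]%n (suc t) k (suc n)))

∑-periodic : ∀ q c .{{_ : NonZero c}} k f → ∑ (q * c) (λ t → f ((t + k) % c)) ≡ q * ∑ c f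
∑-periodic q c k f = begin
  ∑ (q * c) (λ t → f ((t + k) % c))                 ≡⟨ ∑-* q c _ ⟩
  ∑ q (λ s → ∑ c (λ t → f ((s * c + t + k) % c)))
    ≡⟨ ∑-cong q (λ s _ → ∑-cong c (λ t _ → cong f (drop-multiple s t))) ⟩
  ∑ q (λ _ → ∑ c (λ t → f ((t + k) % c)))           ≡⟨ ∑-cong q (λ _ _ → ∑-rotate c k f) ⟩
  ∑ q (const (∑ c f))                               ≡⟨ ∑-const q _ ⟩
  q * ∑ c f                                         ∎
  where
  drop-multiple : ∀ s t → (s * c + t + k) % c ≡ (t + k) % c
  drop-multiple s t =
    trans (cong (_% c) (trans (+-assoc (s * c) t k) (+-comm (s * c) (t + k)))) ([m+kn]%n≡m%n (t + k) s c)

∑-shift : ∀ n .{{_ : NonZero n}} (F G : ℕ → ℕ) {g} → g ≤ n →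
  ∑ n (λ b → F ((b + g) % n) * G b) ≡ ∑ n (λ b → F b * G ((b + (n ∸ g)) % n))
∑-shift n F G {g} g≤n =
  trans (∑-cong n (λ b b<n → cong (F ((b + g) % n) *_) (cong G (sym (unshift b b<n)))))
        (∑-rotate n g (λ b → F b * G ((b + (n ∸ g)) % n)))
  where
  unshift : ∀ b → b < n → ((b + g) % n + (n ∸ g)) % n ≡ b
  unshift b b<n = begin
    ((b + g) % n + (n ∸ g)) % n    ≡⟨ [m%n+o]%n≡[m+o]%n (b + g) (n ∸ g) n ⟩
    (b + g + (n ∸ g)) % n          ≡⟨ cong (_% n) (trans (+-assoc b g (n ∸ g)) (cong (b +_) (m+[n∸m]≡n g≤n))) ⟩
    (b + n) % n                    ≡⟨ [m+n]%n≡m%n b n ⟩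
    b % n                          ≡⟨ m<n⇒m%n≡m b<n ⟩
    b                              ∎

digit : (p c : ℕ) .{{_ : NonZero p}} .{{_ : NonZero c}} → ℕ → ℕ
digit p c x = x / p % c

module _ (p c : ℕ) .{{_ : NonZero p}} .{{_ : NonZero c}} where

  digit-% : ∀ {n} .{{_ : NonZero n}} → c * p ∣ n → ∀ y → digit p c (y % n) ≡ digit p c y
  digit-% {n} cp∣n y = begin
    y % n / p % c          ≡⟨ m%[n*o]/o≡m/o%n (y % n) c p ⟨
    y % n % (c * p) / p    ≡⟨ /-congˡ (m∣n⇒o%n%m≡o%m (c * p) n y cp∣n) ⟩
    y % (c * p) / p        ≡⟨ m%[n*o]/o≡m/o%n y c p ⟩
    y / p % c              ∎
    where instance _ = m*n≢0 c p

  digit-*+ : ∀ s y → digit p c (s * p + y) ≡ (s + y / p) % c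
  digit-*+ s y = cong (_% c) (begin
    (s * p + y) / p        ≡⟨ +-distrib-/-∣ˡ y (divides s refl) ⟩
    s * p / p + y / p      ≡⟨ cong (_+ y / p) (m*n/n≡m s p) ⟩
    s + y / p              ∎)

  digit-*+-multiple : ∀ {n} → c * p ∣ n → ∀ s y → digit p c (s * n + y) ≡ digit p c y
  digit-*+-multiple (divides k refl) s y = begin
    digit p c (s * (k * (c * p)) + y)
      ≡⟨ cong (λ u → digit p c (u + y))
              (solve 4 (λ s k c p → s :* (k :* (c :* p)) := s :* k :* c :* p) refl s k c p) ⟩
    digit p c (s * k * c * p + y)         ≡⟨ digit-*+ (s * k * c) y ⟩
    (s * k * c + y / p) % c               ≡⟨ cong (_% c) (+-comm (s * k * c) (y / p)) ⟩
    (y / p + s * k * c) % c               ≡⟨ [m+kn]%n≡m%n (y / p) (s * k) c ⟩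
    digit p c y                           ∎
    where open +-*-Solver

  ∑-periodic*digit : ∀ {n} q .{{_ : NonZero n}} → n ≡ q * c * p →
    (L : ℕ → ℕ) → (∀ s r → L (s * p + r) ≡ L r) → ∀ f g →
    ∑ n (λ b → L b * f (digit p c ((b + g) % n))) ≡ q * ∑ c f * ∑ p L
  ∑-periodic*digit {n} q n≡qcp L L-periodic f g = begin
    ∑ n F                                              ≡⟨ cong (λ k → ∑ k F) n≡qcp ⟩
    ∑ (q * c * p) F                                    ≡⟨ ∑-* (q * c) p F ⟩
    ∑ (q * c) (λ s → ∑ p (λ r → F (s * p + r)))        ≡⟨ ∑-comm (q * c) p _ ⟩
    ∑ p (λ r → ∑ (q * c) (λ s → F (s * p + r)))        ≡⟨ ∑-cong p (λ r _ → column r) ⟩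
    ∑ p (λ r → q * ∑ c f * L r)                        ≡⟨ ∑-*ˡ p (q * ∑ c f) L ⟩
    q * ∑ c f * ∑ p L                                  ∎
    where
    F : ℕ → ℕ
    F b = L b * f (digit p c ((b + g) % n))
    digit-block : ∀ s r → digit p c ((s * p + r + g) % n) ≡ (s + (r + g) / p) % c
    digit-block s r = begin
      digit p c ((s * p + r + g) % n)   ≡⟨ digit-% (divides q (trans n≡qcp (*-assoc q c p))) _ ⟩
      digit p c (s * p + r + g)         ≡⟨ cong (digit p c) (+-assoc (s * p) r g) ⟩
      digit p c (s * p + (r + g))       ≡⟨ digit-*+ s (r + g) ⟩
      (s + (r + g) / p) % c             ∎
    column : ∀ r → ∑ (q * c) (λ s → F (s * p + r)) ≡ q * ∑ c f * L r
    column r = begin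
      ∑ (q * c) (λ s → F (s * p + r))
        ≡⟨ ∑-cong (q * c) (λ s _ → cong₂ _*_ (L-periodic s r) (cong f (digit-block s r))) ⟩
      ∑ (q * c) (λ s → L r * f ((s + (r + g) / p) % c))   ≡⟨ ∑-*ˡ (q * c) (L r) _ ⟩
      L r * ∑ (q * c) (λ s → f ((s + (r + g) / p) % c))   ≡⟨ cong (L r *_) (∑-periodic q c _ f) ⟩
      L r * (q * ∑ c f)                                    ≡⟨ *-comm (L r) _ ⟩
      q * ∑ c f * L r                                      ∎

  ∑-digit : ∀ {n} q .{{_ : NonZero n}} → n ≡ q * c * p → ∀ f → ∑ n (f ∘ digit p c) ≡ q * ∑ c f * p
  ∑-digit {n} q n≡qcp f = begin
    ∑ n (f ∘ digit p c)                                  ≡⟨ ∑-cong n (λ b b<n → sym (unshifted b b<n)) ⟩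
    ∑ n (λ b → 1 * f (digit p c ((b + 0) % n)))          ≡⟨ ∑-periodic*digit q n≡qcp (const 1) (λ _ _ → refl) f 0 ⟩
    q * ∑ c f * ∑ p (const 1)                            ≡⟨ cong (q * ∑ c f *_) (trans (∑-const p 1) (*-identityʳ p)) ⟩
    q * ∑ c f * p                                        ∎
    where
    unshifted : ∀ b → b < n → 1 * f (digit p c ((b + 0) % n)) ≡ f (digit p c b)
    unshifted b b<n =
      trans (*-identityˡ _) (cong (f ∘ digit p c) (trans (cong (_% n) (+-identityʳ b)) (m<n⇒m%n≡m b<n)))

∏ : ℕ → (ℕ → ℕ) → ℕ
∏ zero    f = 1
∏ (suc n) f = f 0 * ∏ n (f ∘ suc)

∏-+ : ∀ a b f → ∏ (a + b) f ≡ ∏ a f * ∏ b (λ x → f (a + x))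
∏-+ zero    b f = sym (+-identityʳ _)
∏-+ (suc a) b f = trans (cong (f 0 *_) (∏-+ a b (f ∘ suc))) (sym (*-assoc (f 0) _ _))

∏-factor : ∀ f {n q} → q < n → ∏ n f ≡ ∏ (n ∸ suc q) (λ x → f (q + suc x)) * f q * ∏ q f
∏-factor f {n} {q} q<n = begin
  ∏ n f                                       ≡⟨ cong (λ k → ∏ k f) n≡q+1+r ⟩
  ∏ (q + suc r) f                             ≡⟨ ∏-+ q (suc r) f ⟩
  ∏ q f * (f (q + 0) * R)                     ≡⟨ cong (λ k → ∏ q f * (f k * R)) (+-identityʳ q) ⟩
  ∏ q f * (f q * R)                           ≡⟨ solve 3 (λ a b c → a :* (b :* c) := c :* b :* a) refl (∏ q f) (f q) R ⟩
  R * f q * ∏ q f                             ∎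
  where
  open +-*-Solver
  r = n ∸ suc q
  R = ∏ r (λ x → f (q + suc x))
  n≡q+1+r : n ≡ q + suc r
  n≡q+1+r = trans (sym (m+[n∸m]≡n q<n)) (sym (+-suc q r))

∏-nonZero : ∀ n {f} → (∀ x → NonZero (f x)) → NonZero (∏ n f)
∏-nonZero zero    f≢0 = _
∏-nonZero (suc n) f≢0 = m*n≢0 _ _ {{f≢0 0}} {{∏-nonZero n (f≢0 ∘ suc)}}

-- Outside its range the extension is 1, so that it is nonzero whenever f is.
extend : ∀ {n} → (Fin n → ℕ) → ℕ → ℕ
extend {zero}  f x       = 1
extend {suc n} f zero    = f zero
extend {suc n} f (suc x) = extend (f ∘ suc) x

extend-toℕ : ∀ {n} (f : Fin n → ℕ) i → extend f (toℕ i) ≡ f i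
extend-toℕ f zero    = refl
extend-toℕ f (suc i) = extend-toℕ (f ∘ suc) i

extend-nonZero : ∀ {n} {f : Fin n → ℕ} → (∀ i → f i ≢ 0) → ∀ x → NonZero (extend f x)
extend-nonZero {zero}  f≢0 x       = _
extend-nonZero {suc n} f≢0 zero    = ≢-nonZero (f≢0 zero)
extend-nonZero {suc n} f≢0 (suc x) = extend-nonZero (f≢0 ∘ suc) x

product-tabulate : ∀ n (f : Fin n → ℕ) → product (List.tabulate f) ≡ ∏ n (extend f)
product-tabulate zero    f = refl
product-tabulate (suc n) f = cong (f zero *_) (product-tabulate n (f ∘ suc))

prodFin≡∏ : ∀ n (f : Fin n → ℕ) → prodFin n f ≡ ∏ n (extend f)
prodFin≡∏ n f = trans (cong product (map-tabulate id f)) (product-tabulate n f)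

sum-tabulate : ∀ n (f : ℕ → ℕ) → sum (List.tabulate {n = n} (f ∘ toℕ)) ≡ ∑ n f
sum-tabulate zero    f = refl
sum-tabulate (suc n) f = cong (f 0 +_) (sum-tabulate n (f ∘ suc))

ΣFin≡∑ : ∀ n {F : Fin n → ℕ} (f : ℕ → ℕ) → (∀ x → F x ≡ f (toℕ x)) → ΣFin n F ≡ ∑ n f
ΣFin≡∑ n f F≡f = trans (cong sum (trans (map-tabulate id _) (tabulate-cong F≡f))) (sum-tabulate n f)

∣b∷p∣ : ∀ {n} b (p : Subset n) → ∣ b ∷ p ∣ ≡ 𝟙 b + ∣ p ∣
∣b∷p∣ true  p = refl
∣b∷p∣ false p = refl

∣tabulate∣ : ∀ n (f : ℕ → Bool) → ∣ tabulate {n = n} (f ∘ toℕ) ∣ ≡ ∑ n (𝟙 ∘ f)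
∣tabulate∣ zero    f = refl
∣tabulate∣ (suc n) f =
  trans (∣b∷p∣ (f 0) (tabulate {n = n} (f ∘ suc ∘ toℕ))) (cong (𝟙 (f 0) +_) (∣tabulate∣ n (f ∘ suc)))

module _ {N} .{{_ : NonZero N}} where

  IsDiff⇔≡% : (a b g : Fin N) → IsDiff N a b g ⇔ toℕ a ≡ (toℕ b + toℕ g) % N
  IsDiff⇔≡% a b g = mk⇔ to from
    where
    a′ = toℕ a ; b′ = toℕ b ; g′ = toℕ g
    to : IsDiff N a b g → a′ ≡ (b′ + g′) % N
    to (inj₁ g+b≡a)   = sym (trans (cong (_% N) (trans (+-comm b′ g′) g+b≡a)) (m<n⇒m%n≡m (toℕ<n a)))
    to (inj₂ g+b≡a+N) = sym (begin
      (b′ + g′) % N    ≡⟨ cong (_% N) (trans (+-comm b′ g′) g+b≡a+N) ⟩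
      (a′ + N) % N     ≡⟨ [m+n]%n≡m%n a′ N ⟩
      a′ % N           ≡⟨ m<n⇒m%n≡m (toℕ<n a) ⟩
      a′               ∎)
    from : a′ ≡ (b′ + g′) % N → IsDiff N a b g
    from a≡b+g with b′ + g′ <? N
    ... | yes b+g<N = inj₁ (trans (+-comm g′ b′) (sym (trans a≡b+g (m<n⇒m%n≡m b+g<N))))
    ... | no  b+g≮N = inj₂ (trans (+-comm g′ b′) (sym (begin
      a′ + N                    ≡⟨ cong (_+ N) a≡b+g ⟩
      (b′ + g′) % N + N         ≡⟨ cong (_+ N) (m≤n⇒[n∸m]%m≡n%m (≮⇒≥ b+g≮N)) ⟨
      (b′ + g′ ∸ N) % N + N
        ≡⟨ cong (_+ N) (m<n⇒m%n≡m (m<n+o⇒m∸n<o (b′ + g′) N (+-mono-< (toℕ<n b) (toℕ<n g)))) ⟩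
      b′ + g′ ∸ N + N           ≡⟨ m∸n+n≡m (≮⇒≥ b+g≮N) ⟩
      b′ + g′                   ∎)))

  ΔCount-tabulate : ∀ (f g : ℕ → Bool) x →
    ΔCount N (tabulate (f ∘ toℕ)) (tabulate (g ∘ toℕ)) x
      ≡ ∑ N (λ b → 𝟙 (f ((b + toℕ x) % N)) * 𝟙 (g b))
  ΔCount-tabulate f g x = begin
    ΔCount N (tabulate (f ∘ toℕ)) (tabulate (g ∘ toℕ)) x
      ≡⟨ ΣFin≡∑ N _ (λ a → ΣFin≡∑ N _ (entry a)) ⟩
    ∑ N (λ a → ∑ N (λ b → 𝟙 (f a) * 𝟙 (g b) * 𝟙 (a ≡ᵇ (b + toℕ x) % N)))
      ≡⟨ ∑-comm N N _ ⟩
    ∑ N (λ b → ∑ N (λ a → 𝟙 (f a) * 𝟙 (g b) * 𝟙 (a ≡ᵇ (b + toℕ x) % N)))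
      ≡⟨ ∑-cong N (λ b _ → ∑-select N (λ a → 𝟙 (f a) * 𝟙 (g b)) (m%n<n (b + toℕ x) N)) ⟩
    ∑ N (λ b → 𝟙 (f ((b + toℕ x) % N)) * 𝟙 (g b))   ∎
    where
    entry : ∀ a b →
      𝟙 (lookup (tabulate (f ∘ toℕ)) a ∧ lookup (tabulate (g ∘ toℕ)) b ∧ ⌊ isDiff? N a b x ⌋)
        ≡ 𝟙 (f (toℕ a)) * 𝟙 (g (toℕ b)) * 𝟙 (toℕ a ≡ᵇ (toℕ b + toℕ x) % N)
    entry a b = begin
      𝟙 (lookup (tabulate (f ∘ toℕ)) a ∧ lookup (tabulate (g ∘ toℕ)) b ∧ ⌊ isDiff? N a b x ⌋)
        ≡⟨ cong₂ (λ u v → 𝟙 (u ∧ v ∧ ⌊ isDiff? N a b x ⌋))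
                 (lookup∘tabulate (f ∘ toℕ) a) (lookup∘tabulate (g ∘ toℕ) b) ⟩
      𝟙 (f (toℕ a) ∧ g (toℕ b) ∧ ⌊ isDiff? N a b x ⌋)
        ≡⟨ cong (λ u → 𝟙 (f (toℕ a) ∧ g (toℕ b) ∧ u))
                (trans (isYes≗does (isDiff? N a b x))
                       (does-⇔ (IsDiff⇔≡% a b x) (isDiff? N a b x) (toℕ a ≟ _))) ⟩
      𝟙 (f (toℕ a) ∧ g (toℕ b) ∧ (toℕ a ≡ᵇ (toℕ b + toℕ x) % N))
        ≡⟨ 𝟙-∧ (f (toℕ a)) (g (toℕ b)) _ ⟩
      𝟙 (f (toℕ a)) * 𝟙 (g (toℕ b)) * 𝟙 (toℕ a ≡ᵇ (toℕ b + toℕ x) % N)   ∎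

ℚ[]≡mkℚ : ∀ n → ℚ[ n ] ≡ mkℚ (ℤ.+ n) 0 (Coprimality.sym (1-coprimeTo n))
ℚ[]≡mkℚ n = ℚ.normalize-coprime _

ℚ[]-* : ∀ a b → ℚ[ a * b ] ≡ ℚ[ a ] ℚ.* ℚ[ b ]
ℚ[]-* a b rewrite ℚ[]≡mkℚ a | ℚ[]≡mkℚ b = cong (ℚ._/ 1) (ℤ.pos-* a b)

ℚ[]-injective : ∀ {a b} → ℚ[ a ] ≡ ℚ[ b ] → a ≡ b
ℚ[]-injective {a} {b} eq rewrite ℚ[]≡mkℚ a | ℚ[]≡mkℚ b = ℤ.+-injective (proj₁ (ℚ.mkℚ-injective eq))

ℚ[]-cancel-< : ∀ {a b} → ℚ[ a ] ℚ.< ℚ[ b ] → a < b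
ℚ[]-cancel-< {a} {b} lt rewrite ℚ[]≡mkℚ a | ℚ[]≡mkℚ b with ℚ.drop-*<* lt
... | a*1<b*1 rewrite ℤ.*-identityʳ (ℤ.+ a) | ℤ.*-identityʳ (ℤ.+ b) = ℤ.drop‿+<+ a*1<b*1

ℚ[]-positive : ∀ n .{{_ : NonZero n}} → ℚ.Positive ℚ[ n ]
ℚ[]-positive (suc n) rewrite ℚ[]≡mkℚ (suc n) = _

ℚ[]-scale<1⇒< : ∀ {z} c d .{{_ : NonZero c}} → z ℚ.< 1ℚ → ℚ[ d ] ≡ z ℚ.* ℚ[ c ] → d < c
ℚ[]-scale<1⇒< c d z<1 d≡zc = ℚ[]-cancel-<
  (subst₂ ℚ._<_ (sym d≡zc) (ℚ.*-identityˡ ℚ[ c ]) (ℚ.*-monoˡ-<-pos ℚ[ c ] {{ℚ[]-positive c}} z<1))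

ℚ[]-scale : ∀ q c p d s {n} z w → n ≡ q * c * p →
  ℚ[ d ] ≡ z ℚ.* ℚ[ c ] → ℚ[ s ] ≡ ℚ[ p ] ℚ.* w → ℚ[ q * d * s ] ≡ ℚ[ n ] ℚ.* z ℚ.* w
ℚ[]-scale q c p d s {n} z w n≡qcp d≡zc s≡pw = begin
  ℚ[ q * d * s ]                              ≡⟨ ℚ[]-*₃ q d s ⟩
  ℚ[ q ] ℚ.* ℚ[ d ] ℚ.* ℚ[ s ]                ≡⟨ cong₂ (λ u v → ℚ[ q ] ℚ.* u ℚ.* v) d≡zc s≡pw ⟩
  ℚ[ q ] ℚ.* (z ℚ.* ℚ[ c ]) ℚ.* (ℚ[ p ] ℚ.* w)
    ≡⟨ solve 5 (λ q c p z w → q :* (z :* c) :* (p :* w) := q :* c :* p :* z :* w)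
               refl ℚ[ q ] ℚ[ c ] ℚ[ p ] z w ⟩
  ℚ[ q ] ℚ.* ℚ[ c ] ℚ.* ℚ[ p ] ℚ.* z ℚ.* w
    ≡⟨ cong (λ u → u ℚ.* z ℚ.* w) (trans (sym (ℚ[]-*₃ q c p)) (cong ℚ[_] (sym n≡qcp))) ⟩
  ℚ[ n ] ℚ.* z ℚ.* w                          ∎
  where
  open ℚ-Solver
  ℚ[]-*₃ : ∀ a b e → ℚ[ a * b * e ] ≡ ℚ[ a ] ℚ.* ℚ[ b ] ℚ.* ℚ[ e ]
  ℚ[]-*₃ a b e = trans (ℚ[]-* (a * b) e) (cong (ℚ._* ℚ[ e ]) (ℚ[]-* a b))

ℚ[]-scale₁ : ∀ q c p d {n} z → n ≡ q * c * p →
  ℚ[ d ] ≡ z ℚ.* ℚ[ c ] → ℚ[ q * d * p ] ≡ ℚ[ n ] ℚ.* z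
ℚ[]-scale₁ q c p d {n} z n≡qcp d≡zc =
  trans (ℚ[]-scale q c p d p z 1ℚ n≡qcp d≡zc (sym (ℚ.*-identityʳ ℚ[ p ])))
        (ℚ.*-identityʳ (ℚ[ n ] ℚ.* z))

module Construction {m} (c : Fin (suc m) → ℕ) (d : Fin m → ℕ)
                    (c≢0 : ∀ j → c j ≢ 0) (d≤c : ∀ i → d i ≤ c (inject₁ i)) where

  -- C q and P q are the base and the place value of digit q.
  C : ℕ → ℕ
  C = extend c

  P : ℕ → ℕ
  P q = ∏ q C

  N : ℕ
  N = prodFin (suc m) c

  C-nonZero : ∀ q → NonZero (C q)
  C-nonZero = extend-nonZero c≢0

  P-nonZero : ∀ q → NonZero (P q)
  P-nonZero q = ∏-nonZero q C-nonZero

  instance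
    N-nonZero : NonZero N
    N-nonZero = subst NonZero (sym (prodFin≡∏ (suc m) c)) (P-nonZero (suc m))

  inA : Fin m → ℕ → Bool
  inA i x = digit (P q) (C q) {{P-nonZero q}} {{C-nonZero q}} x <ᵇ d i
    where q = toℕ i

  A : Fin m → Subset N
  A i = tabulate (inA i ∘ toℕ)

  ∏C-between : ℕ → ℕ → ℕ
  ∏C-between q n = ∏ (n ∸ suc q) (λ x → C (q + suc x))

  P-factor : ∀ {q n} → q < n → P n ≡ ∏C-between q n * C q * P q
  P-factor = ∏-factor C

  N-factor : (i : Fin m) → N ≡ ∏C-between (toℕ i) (suc m) * C (toℕ i) * P (toℕ i)
  N-factor i = trans (prodFin≡∏ (suc m) c) (P-factor (m<n⇒m<1+n (toℕ<n i)))

  C-toℕ : (i : Fin m) → C (toℕ i) ≡ c (inject₁ i)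
  C-toℕ i = trans (cong C (sym (toℕ-inject₁ i))) (extend-toℕ c (inject₁ i))

  d≤C : ∀ i → d i ≤ C (toℕ i)
  d≤C i = subst (d i ≤_) (sym (C-toℕ i)) (d≤c i)

  ∑-inA : ∀ i k {n} .{{_ : NonZero n}} → n ≡ k * C (toℕ i) * P (toℕ i) →
    ∑ n (𝟙 ∘ inA i) ≡ k * d i * P (toℕ i)
  ∑-inA i k {n} n≡kCP = begin
    ∑ n (𝟙 ∘ inA i)                             ≡⟨ ∑-digit (P q) (C q) k n≡kCP (λ t → 𝟙 (t <ᵇ d i)) ⟩
    k * ∑ (C q) (λ t → 𝟙 (t <ᵇ d i)) * P q      ≡⟨ cong (λ u → k * u * P q) (∑-indicator-< (C q) (d≤C i)) ⟩
    k * d i * P q                               ∎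
    where
    q = toℕ i
    instance _ = C-nonZero q ; _ = P-nonZero q

  ∣A∣≡ : ∀ i → ∣ A i ∣ ≡ ∏C-between (toℕ i) (suc m) * d i * P (toℕ i)
  ∣A∣≡ i = trans (∣tabulate∣ N (inA i)) (∑-inA i (∏C-between (toℕ i) (suc m)) (N-factor i))

  multiplicity : Fin m → Fin m → ℕ
  multiplicity i j = ∏C-between (toℕ j) (suc m) * d j * (∏C-between (toℕ i) (toℕ j) * d i * P (toℕ i))

  inA-periodic : (i j : Fin m) → toℕ i < toℕ j → ∀ s r → 𝟙 (inA i (s * P (toℕ j) + r)) ≡ 𝟙 (inA i r)
  inA-periodic i j i<j s r = cong (λ u → 𝟙 (u <ᵇ d i)) (digit-*+-multiple (P p) (C p) CP∣P s r)
    where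
    p = toℕ i
    instance _ = C-nonZero p ; _ = P-nonZero p
    CP∣P : C p * P p ∣ P (toℕ j)
    CP∣P = divides (∏C-between p (toℕ j)) (trans (P-factor i<j) (*-assoc (∏C-between p (toℕ j)) (C p) (P p)))

  ∑-inA*inA : (i j : Fin m) → toℕ i < toℕ j → ∀ g →
    ∑ N (λ b → 𝟙 (inA i b) * 𝟙 (inA j ((b + g) % N))) ≡ multiplicity i j
  ∑-inA*inA i j i<j g = begin
    ∑ N (λ b → 𝟙 (inA i b) * 𝟙 (inA j ((b + g) % N)))
      ≡⟨ ∑-periodic*digit (P q) (C q) k (N-factor j) (𝟙 ∘ inA i) (inA-periodic i j i<j)
                          (λ t → 𝟙 (t <ᵇ d j)) g ⟩
    k * ∑ (C q) (λ t → 𝟙 (t <ᵇ d j)) * ∑ (P q) (𝟙 ∘ inA i)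
      ≡⟨ cong₂ (λ u v → k * u * v) (∑-indicator-< (C q) (d≤C j))
                                   (∑-inA i (∏C-between (toℕ i) q) (P-factor i<j)) ⟩
    multiplicity i j   ∎
    where
    q = toℕ j
    k = ∏C-between q (suc m)
    instance _ = C-nonZero q ; _ = P-nonZero q

  ΔCount-A< : (i j : Fin m) → toℕ i < toℕ j → ∀ g → ΔCount N (A i) (A j) g ≡ multiplicity i j
  ΔCount-A< i j i<j g = begin
    ΔCount N (A i) (A j) g                                          ≡⟨ ΔCount-tabulate (inA i) (inA j) g ⟩
    ∑ N (λ b → 𝟙 (inA i ((b + toℕ g) % N)) * 𝟙 (inA j b))
      ≡⟨ ∑-shift N (𝟙 ∘ inA i) (𝟙 ∘ inA j) (<⇒≤ (toℕ<n g)) ⟩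
    ∑ N (λ b → 𝟙 (inA i b) * 𝟙 (inA j ((b + (N ∸ toℕ g)) % N)))   ≡⟨ ∑-inA*inA i j i<j (N ∸ toℕ g) ⟩
    multiplicity i j                                                ∎

  ΔCount-A> : (i j : Fin m) → toℕ i < toℕ j → ∀ g → ΔCount N (A j) (A i) g ≡ multiplicity i j
  ΔCount-A> i j i<j g = begin
    ΔCount N (A j) (A i) g                                  ≡⟨ ΔCount-tabulate (inA j) (inA i) g ⟩
    ∑ N (λ b → 𝟙 (inA j ((b + toℕ g) % N)) * 𝟙 (inA i b))
      ≡⟨ ∑-cong N (λ b _ → *-comm (𝟙 (inA j ((b + toℕ g) % N))) (𝟙 (inA i b))) ⟩
    ∑ N (λ b → 𝟙 (inA i b) * 𝟙 (inA j ((b + toℕ g) % N)))  ≡⟨ ∑-inA*inA i j i<j (toℕ g) ⟩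
    multiplicity i j                                        ∎

  module _ (z : ℚ) (d≡zc : ∀ i → ℚ[ d i ] ≡ z ℚ.* ℚ[ c (inject₁ i) ]) where

    d≡zC : ∀ i → ℚ[ d i ] ≡ z ℚ.* ℚ[ C (toℕ i) ]
    d≡zC i = trans (d≡zc i) (cong (λ u → z ℚ.* ℚ[ u ]) (sym (C-toℕ i)))

    ∣A∣-ℚ : ∀ i → ℚ[ ∣ A i ∣ ] ≡ ℚ[ N ] ℚ.* z
    ∣A∣-ℚ i = trans (cong ℚ[_] (∣A∣≡ i))
      (ℚ[]-scale₁ (∏C-between q (suc m)) (C q) (P q) (d i) z (N-factor i) (d≡zC i))
      where q = toℕ i

    multiplicity-ℚ : (i j : Fin m) → toℕ i < toℕ j → ℚ[ multiplicity i j ] ≡ ℚ[ N ] ℚ.* z ℚ.* z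
    multiplicity-ℚ i j i<j =
      ℚ[]-scale (∏C-between q (suc m)) (C q) (P q) (d j) (∏C-between p q * d i * P p) z z (N-factor j) (d≡zC j)
        (ℚ[]-scale₁ (∏C-between p q) (C p) (P p) (d i) z (P-factor i<j) (d≡zC i))
      where p = toℕ i ; q = toℕ j

    ΔCount-ℚ : ∀ i j → i ≢ j → ∀ g → ℚ[ ΔCount N (A i) (A j) g ] ≡ ℚ[ N ] ℚ.* z ℚ.* z
    ΔCount-ℚ i j i≢j g = by-order (<-cmp (toℕ i) (toℕ j))
      where
      by-order : Tri (toℕ i < toℕ j) (toℕ i ≡ toℕ j) (toℕ i > toℕ j) →
        ℚ[ ΔCount N (A i) (A j) g ] ≡ ℚ[ N ] ℚ.* z ℚ.* z
      by-order (tri< i<j _ _) = trans (cong ℚ[_] (ΔCount-A< i j i<j g)) (multiplicity-ℚ i j i<j)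
      by-order (tri≈ _ i≡j _) = contradiction (toℕ-injective i≡j) i≢j
      by-order (tri> _ _ j<i) = trans (cong ℚ[_] (ΔCount-A> j i j<i g)) (multiplicity-ℚ j i j<i)

theorem3p4 : (m : ℕ) → 2 ≤ m → (d : Fin m → ℕ) → (c : Fin (suc m) → ℕ) →
    (∀ j → c j ≢ 0) →
    (z : ℚ) → 0ℚ ℚ.< z → z ℚ.< 1ℚ →
    (∀ i → ℚ[ d i ] ≡ z ℚ.* ℚ[ c (inject₁ i) ]) →
    Σ ℕ λ k → Σ ℕ λ l →
      (ℚ[ k ] ≡ ℚ[ prodFin (suc m) c ] ℚ.* z) ×
      (ℚ[ l ] ≡ ℚ[ prodFin (suc m) c ] ℚ.* z ℚ.* z) ×
      ∃ λ (A : Fin m → Subset (prodFin (suc m) c)) →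
        IsPSEDF (prodFin (suc m) c) m k l A
theorem3p4 m 1<m@(s≤s (s≤s _)) d c c≢0 z _ z<1 d≡zc =
  k , l , ∣A∣-ℚ z d≡zc i₀ , ΔCount-ℚ z d≡zc i₀ i₁ i₀≢i₁ g₀ , A , 1<m , sizes , multiplicities
  where
  d≤c : ∀ i → d i ≤ c (inject₁ i)
  d≤c i = <⇒≤ (ℚ[]-scale<1⇒< (c (inject₁ i)) (d i) {{≢-nonZero (c≢0 (inject₁ i))}} z<1 (d≡zc i))
  open Construction c d c≢0 d≤c
  i₀ i₁ : Fin m
  i₀ = zero
  i₁ = suc zero
  i₀≢i₁ : i₀ ≢ i₁
  i₀≢i₁ ()
  g₀ : Fin N
  g₀ = fromℕ< (>-nonZero⁻¹ N)
  k l : ℕ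
  k = ∣ A i₀ ∣
  l = ΔCount N (A i₀) (A i₁) g₀
  sizes : ∀ i → ∣ A i ∣ ≡ k
  sizes i = ℚ[]-injective (trans (∣A∣-ℚ z d≡zc i) (sym (∣A∣-ℚ z d≡zc i₀)))
  multiplicities : ∀ i j → i ≢ j → ∀ g → ΔCount N (A i) (A j) g ≡ l
  multiplicities i j i≢j g =
    ℚ[]-injective (trans (ΔCount-ℚ z d≡zc i j i≢j g) (sym (ΔCount-ℚ z d≡zc i₀ i₁ i₀≢i₁ g₀)))
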